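{- Let $n$ be even and let $f:\{0,1\}^n\to\{0,1\}$ be a Boolean function such that for every $n'\le n/2$ and every $b\in\{0,1,*\}^n$ with $b_i=b_{n/2+i}=*$ for all $i\in\{n'+1,\dots,n/2\}$, the following hold: (1) if for every $i\in\{1,\dots,n'\}$ exactly one of $b_i,b_{n/2+i}$ equals $*$ and the other equals $1$, then $b$ is neither a $0$-certificate nor a $1$-certificate of $f$; and (2) if for every $i\in\{1,\dots,n'-1\}$ exactly one of $b_i,b_{n/2+i}$ equals $*$ and the other equals $1$, and $b_{n'}=b_{n/2+n'}=1$, then $b$ contains a $1$-certificate of $f$. Then the $Q$-value of $f$ is at least $2^{n/2}$.
   Context: A partial assignment is $b\in\{0,1,*\}^n$. For partial assignments $a,b$, $a$ extends $b$ (written $a\sim b$; also $b$ is contained in $a$) if $a_i=b_i$ whenever $b_i\ne *$. For $i\in\{1,\dots,n\}$ and $l\in\{0,1\}$, $b_{x_i\leftarrow l}$ is $b$ with its $i$-th coordinate set to $l$. $b$ is a $0$-certificate ($1$-certificate) of $f$ if $f(a)=0$ ($f(a)=1$) for all $a\in\{0,1\}^n$ with $a\sim b$. A utility function $g:\{0,1,*\}^n\to\mathbb{Z}_{\ge0}$ is monotone if $g(b_{x_i\leftarrow l})\ge g(b)$ whenever $b_i=*$, $l\in\{0,1\}$; it is submodular if $g(b_{x_i\leftarrow l})-g(b)\ge g(b'_{x_i\leftarrow l})-g(b')$ whenever $b'\sim b$, $b_i=b'_i=*$, $l\in\{0,1\}$. A utility function $g$ is assignment feasible for $f$ with goal value $Q$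 if (i) $g$ is monotone and submodular, (ii) $g(*,\dots,*)=0$, and (iii) for all $b\in\{0,1,*\}^n$, $g(b)=Q$ iff $b$ is a $0$-certificate or a $1$-certificate of $f$. The $Q$-value of $f$ is the minimum integer $Q$ such that there exists an (integer-valued) utility function that is assignment feasible for $f$ with goal value $Q$. -}

module Defs where

open import Data.Nat using (ℕ; zero; suc; _+_; _≤_; _<_)
open import Data.Fin using (Fin; toℕ; _↑ˡ_; _↑ʳ_; _≟_)
open import Data.Bool using (Bool; true; false)
open import Data.Maybe using (Maybe; just; nothing)
open import Data.Product using (Σ; _×_; _,_)
open import Data.Sum using (_⊎_)
open import Relation.Nullary using (¬_; yes; no)
open import Relation.Binary.PropositionalEquality using (_≡_)

-- A partial assignment b ∈ {0,1,*}^n : nothing = *, just false = 0, just true = 1.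
PA : ℕ → Set
PA n = Fin n → Maybe Bool

_extends_ : ∀ {n} → PA n → PA n → Set
a extends b = ∀ i l → b i ≡ just l → a i ≡ just l

total : ∀ {n} → (Fin n → Bool) → PA n
total a i = just (a i)

set : ∀ {n} → PA n → Fin n → Bool → PA n
set b i l j with j ≟ i
... | yes _ = just l
... | no _ = b j

Certificate : ∀ {n} → ((Fin n → Bool) → Bool) → Bool → PA n → Set
Certificate {n} f l b = ∀ (a : Fin n → Bool) → total a extends b → f a ≡ l

IsCertificate : ∀ {n} → ((Fin n → Bool) → Bool) → PA n → Set
IsCertificate f b = Certificate f false b ⊎ Certificate f true b

Monotone : ∀ {n} → (PA n → ℕ) → Set
Monotone {n} g = ∀ (b : PA n) i l → b i ≡ nothing → g b ≤ g (set b i l)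

-- g(b_{x_i←l}) - g(b) ≥ g(b'_{x_i←l}) - g(b'), written additively (exact over ℤ).
Submodular : ∀ {n} → (PA n → ℕ) → Set
Submodular {n} g = ∀ (b b' : PA n) i l → b' extends b → b i ≡ nothing → b' i ≡ nothing →
  g (set b' i l) + g b ≤ g (set b i l) + g b'

AssignmentFeasible : ∀ {n} → ((Fin n → Bool) → Bool) → (PA n → ℕ) → ℕ → Set
AssignmentFeasible {n} f g Q =
  Monotone g × Submodular g × g (λ _ → nothing) ≡ 0 ×
  (∀ (b : PA n) → (g b ≡ Q → IsCertificate f b) × (IsCertificate f b → g b ≡ Q))

-- The Q-value of f (the minimum feasible goal value) is at least k:
-- every goal value Q admitting an assignment-feasible utility satisfies k ≤ Q.
QValueAtLeast : ∀ {n} → ((Fin n → Bool) → Bool) → ℕ → Set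
QValueAtLeast {n} f k = ∀ (Q : ℕ) (g : PA n → ℕ) → AssignmentFeasible f g Q → k ≤ Q

-- Even n = m + m; for i : Fin m, coordinates i and m+i.
lft : ∀ {m} → Fin m → Fin (m + m)
lft {m} i = i ↑ˡ m

rgt : ∀ {m} → Fin m → Fin (m + m)
rgt {m} i = m ↑ʳ i

OneStarOneOne : ∀ {m} → PA (m + m) → Fin m → Set
OneStarOneOne b i =
  (b (lft i) ≡ nothing × b (rgt i) ≡ just true) ⊎ (b (lft i) ≡ just true × b (rgt i) ≡ nothing)

BothStar : ∀ {m} → PA (m + m) → Fin m → Set
BothStar b i = b (lft i) ≡ nothing × b (rgt i) ≡ nothing

BothOne : ∀ {m} → PA (m + m) → Fin m → Set
BothOne b i = b (lft i) ≡ just true × b (rgt i) ≡ just true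

ContainsCertificate : ∀ {n} → ((Fin n → Bool) → Bool) → Bool → PA n → Set
ContainsCertificate {n} f l b = Σ (PA n) λ c → b extends c × Certificate f l c

-- Call b a stage-k assignment if each of the first k pairs (i, m+i) carries a single 1 and the
-- other pairs are unassigned; by hypothesis (1) it is no certificate, so g b < Q.  Setting one
-- coordinate of pair k to 1 gives stage-(k+1) assignments bˡ, bʳ, and setting both gives a
-- 1-certificate by hypothesis (2), of utility Q.  Submodularity at the second coordinate, from b
-- and from bˡ, gives Q + g b ≤ g bʳ + g bˡ: the gap Q − g b is at least the sum of the gaps of
-- bˡ and bʳ.  The gap is ≥ 1 at stage m, hence ≥ 2^m for the empty assignment, whose utility is 0.
module Submission where

open import Defs
open import Data.Nat using (ℕ; zero; suc; _+_; _*_; _≤_; _<_; _^_; s≤s; z≤n)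
open import Data.Nat.Properties
  using (≤-refl; ≤-reflexive; <⇒≤; <⇒≢; ≤∧≢⇒<; m<m+n; m<1+n⇒m<n∨m≡n; suc-injective;
         +-comm; +-suc; +-identityʳ; +-mono-≤; +-monoˡ-≤; +-cancelˡ-≤; module ≤-Reasoning)
open import Data.Nat.Solver using (module +-*-Solver)
open import Data.Fin using (Fin; toℕ; fromℕ<; splitAt; _≟_)
open import Data.Fin.Properties
  using (toℕ<n; toℕ-fromℕ<; toℕ-injective; splitAt-↑ˡ; splitAt-↑ʳ; ↑ˡ-injective; ↑ʳ-injective)
open import Data.Bool using (Bool; true; false)
open import Data.Maybe using (just; nothing)
open import Data.Product using (_×_; _,_; proj₁; proj₂)
open import Data.Sum using (_⊎_; inj₁; inj₂; [_,_])
open import Relation.Nullary using (¬_; yes; no; contradiction)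
open import Relation.Binary.PropositionalEquality using (_≡_; _≢_; refl; sym; trans; cong; subst)
open import Function using (_∘_)

set-≡ : ∀ {n} (b : PA n) j l → set b j l j ≡ just l
set-≡ b j l with j ≟ j
... | yes _ = refl
... | no j≢j = contradiction refl j≢j

set-≢ : ∀ {n} (b : PA n) j l {j'} → j' ≢ j → set b j l j' ≡ b j'
set-≢ b j l {j'} j'≢j with j' ≟ j
... | yes j'≡j = contradiction j'≡j j'≢j
... | no _ = refl

set-extends : ∀ {n} (b : PA n) j l → b j ≡ nothing → set b j l extends b
set-extends b j l bj≡* j' l' bj'≡l' with j' ≟ j
... | yes refl with () ← trans (sym bj≡*) bj'≡l'
... | no _ = bj'≡l'

certificate-extends : ∀ {n} {f : (Fin n → Bool) → Bool} {l} {b c : PA n} →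
  b extends c → Certificate f l c → Certificate f l b
certificate-extends b⊇c cert a a⊇b = cert a (λ j l cj≡l → a⊇b j l (b⊇c j l cj≡l))

module Pairs (m : ℕ) where

  lft≢rgt : (i j : Fin m) → lft i ≢ rgt j
  lft≢rgt i j eq with () ← trans (sym (splitAt-↑ˡ m i m)) (trans (cong (splitAt m) eq) (splitAt-↑ʳ m m j))

  record Stage (k : ℕ) (b : PA (m + m)) : Set where
    constructor stage
    field
      unset-from : ∀ (i : Fin m) → k ≤ toℕ i → BothStar b i
      single-one-below : ∀ (i : Fin m) → toℕ i < k → OneStarOneOne b i

  open Stage public

  stage-empty : Stage 0 (λ _ → nothing)
  stage-empty = stage (λ _ _ → refl , refl) (λ _ ())

  record AgreeOff (k : Fin m) (b b' : PA (m + m)) : Set where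
    constructor agreeOff
    field
      agree : ∀ i → i ≢ k → b' (lft i) ≡ b (lft i) × b' (rgt i) ≡ b (rgt i)

  open AgreeOff public

  agreeOff-setˡ : ∀ k (b : PA (m + m)) l → AgreeOff k b (set b (lft k) l)
  agreeOff-setˡ k b l = agreeOff λ i i≢k →
    set-≢ b (lft k) l (i≢k ∘ ↑ˡ-injective m i k) , set-≢ b (lft k) l (lft≢rgt k i ∘ sym)

  agreeOff-setʳ : ∀ k (b : PA (m + m)) l → AgreeOff k b (set b (rgt k) l)
  agreeOff-setʳ k b l = agreeOff λ i i≢k →
    set-≢ b (rgt k) l (lft≢rgt i k) , set-≢ b (rgt k) l (i≢k ∘ ↑ʳ-injective m i k)

  agreeOff-trans : ∀ {k} {b b' b'' : PA (m + m)} → AgreeOff k b b' → AgreeOff k b' b'' → AgreeOff k b b''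
  agreeOff-trans b~b' b'~b'' = agreeOff λ i i≢k →
    trans (proj₁ (agree b'~b'' i i≢k)) (proj₁ (agree b~b' i i≢k)) ,
    trans (proj₂ (agree b'~b'' i i≢k)) (proj₂ (agree b~b' i i≢k))

  module _ {k : Fin m} {b b' : PA (m + m)} (b~b' : AgreeOff k b b') {i : Fin m} (i≢k : i ≢ k) where

    private
      agree-lft = proj₁ (agree b~b' i i≢k)
      agree-rgt = proj₂ (agree b~b' i i≢k)

    agreeOff-BothStar : BothStar b i → BothStar b' i
    agreeOff-BothStar (l , r) = trans agree-lft l , trans agree-rgt r

    agreeOff-OneStarOneOne : OneStarOneOne b i → OneStarOneOne b' i
    agreeOff-OneStarOneOne (inj₁ (l , r)) = inj₁ (trans agree-lft l , trans agree-rgt r)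
    agreeOff-OneStarOneOne (inj₂ (l , r)) = inj₂ (trans agree-lft l , trans agree-rgt r)

  module _ {k : Fin m} {b b' : PA (m + m)} (b-stage : Stage (toℕ k) b) (b~b' : AgreeOff k b b') where

    unset-above : ∀ (i : Fin m) → suc (toℕ k) ≤ toℕ i → BothStar b' i
    unset-above i k<i =
      agreeOff-BothStar b~b' (λ i≡k → <⇒≢ k<i (sym (cong toℕ i≡k))) (unset-from b-stage i (<⇒≤ k<i))

    single-one-before : ∀ (i : Fin m) → toℕ i < toℕ k → OneStarOneOne b' i
    single-one-before i i<k =
      agreeOff-OneStarOneOne b~b' (λ i≡k → <⇒≢ i<k (cong toℕ i≡k)) (single-one-below b-stage i i<k)

    stage-suc : OneStarOneOne b' k → Stage (suc (toℕ k)) b'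
    stage-suc pair = stage unset-above λ i i≤k → single-one-upTo i (m<1+n⇒m<n∨m≡n i≤k)
      where
        single-one-upTo : ∀ (i : Fin m) → toℕ i < toℕ k ⊎ toℕ i ≡ toℕ k → OneStarOneOne b' i
        single-one-upTo i (inj₁ i<k) = single-one-before i i<k
        single-one-upTo i (inj₂ i≡k) rewrite toℕ-injective {i = i} i≡k = pair

-- Subtraction-free form of: q − x ≥ (q − l) + (q − r) with both summands ≥ p, hence q − x ≥ 2p.
gap-doubling : ∀ {q x l r} p → q + x ≤ r + l → l + p ≤ q → r + p ≤ q → x + 2 * p ≤ q
gap-doubling {q} {x} {l} {r} p split l+p≤q r+p≤q = +-cancelˡ-≤ q _ _ (begin
    q + (x + 2 * p)       ≡⟨ solve 3 (λ q x p → q :+ (x :+ con 2 :* p) := (q :+ x) :+ (p :+ p)) refl q x p ⟩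
    (q + x) + (p + p)     ≤⟨ +-monoˡ-≤ (p + p) split ⟩
    (r + l) + (p + p)     ≡⟨ solve 3 (λ r l p → (r :+ l) :+ (p :+ p) := (r :+ p) :+ (l :+ p)) refl r l p ⟩
    (r + p) + (l + p)     ≤⟨ +-mono-≤ r+p≤q l+p≤q ⟩
    q + q                 ∎)
  where open ≤-Reasoning
        open +-*-Solver

module LowerBound {m : ℕ} {f : (Fin (m + m) → Bool) → Bool}
    (noCertificate : ∀ (n' : ℕ) → n' ≤ m → (b : PA (m + m)) →
      (∀ (i : Fin m) → n' ≤ toℕ i → BothStar b i) →
      (∀ (i : Fin m) → toℕ i < n' → OneStarOneOne b i) →
      ¬ Certificate f false b × ¬ Certificate f true b)
    (containsCertificate : ∀ (n' : ℕ) → 1 ≤ n' → n' ≤ m → (b : PA (m + m)) →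
      (∀ (i : Fin m) → n' ≤ toℕ i → BothStar b i) →
      (∀ (i : Fin m) → suc (toℕ i) < n' → OneStarOneOne b i) →
      (∀ (i : Fin m) → suc (toℕ i) ≡ n' → BothOne b i) →
      ContainsCertificate f true b)
    {Q : ℕ} {g : PA (m + m) → ℕ} (monotone : Monotone g) (submodular : Submodular g)
    (goal⇔certificate : ∀ b → (g b ≡ Q → IsCertificate f b) × (IsCertificate f b → g b ≡ Q))
    where

  open Pairs m

  below-goal : ∀ {k} {b : PA (m + m)} → k ≤ m → Stage k b → g b ≤ Q → g b < Q
  below-goal {k} {b} k≤m b-stage gb≤Q =
    ≤∧≢⇒< gb≤Q ([ proj₁ noCertificate-b , proj₂ noCertificate-b ] ∘ proj₁ (goal⇔certificate b))
    where noCertificate-b = noCertificate k k≤m b (unset-from b-stage) (single-one-below b-stage)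

  goal-at-BothOne : ∀ {k : Fin m} {b b' : PA (m + m)} →
    Stage (toℕ k) b → AgreeOff k b b' → BothOne b' k → g b' ≡ Q
  goal-at-BothOne {k} {b} {b'} b-stage b~b' pair =
    let (_ , b'⊇c , cert) = containsCertificate (suc (toℕ k)) (s≤s z≤n) (toℕ<n k) b'
          (unset-above b-stage b~b') (λ { i (s≤s i<k) → single-one-before b-stage b~b' i i<k }) both-one
    in proj₂ (goal⇔certificate b') (inj₂ (certificate-extends b'⊇c cert))
    where
      both-one : ∀ (i : Fin m) → suc (toℕ i) ≡ suc (toℕ k) → BothOne b' i
      both-one i i≡k rewrite toℕ-injective {i = i} (suc-injective i≡k) = pair

  module Branches {k : Fin m} {b : PA (m + m)} (b-stage : Stage (toℕ k) b) where

    pair-unset : BothStar b k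
    pair-unset = unset-from b-stage k ≤-refl

    bˡ bʳ bˡʳ bʳˡ : PA (m + m)
    bˡ = set b (lft k) true
    bʳ = set b (rgt k) true
    bˡʳ = set bˡ (rgt k) true
    bʳˡ = set bʳ (lft k) true

    bˡ-rgt : bˡ (rgt k) ≡ nothing
    bˡ-rgt = trans (set-≢ b (lft k) true (lft≢rgt k k ∘ sym)) (proj₂ pair-unset)

    bʳ-lft : bʳ (lft k) ≡ nothing
    bʳ-lft = trans (set-≢ b (rgt k) true (lft≢rgt k k)) (proj₁ pair-unset)

    stageˡ : Stage (suc (toℕ k)) bˡ
    stageˡ = stage-suc b-stage (agreeOff-setˡ k b true) (inj₂ (set-≡ b (lft k) true , bˡ-rgt))

    stageʳ : Stage (suc (toℕ k)) bʳ
    stageʳ = stage-suc b-stage (agreeOff-setʳ k b true) (inj₁ (bʳ-lft , set-≡ b (rgt k) true))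

    gbˡʳ≡Q : g bˡʳ ≡ Q
    gbˡʳ≡Q = goal-at-BothOne b-stage (agreeOff-trans (agreeOff-setˡ k b true) (agreeOff-setʳ k bˡ true))
      (trans (set-≢ bˡ (rgt k) true (lft≢rgt k k)) (set-≡ b (lft k) true) , set-≡ bˡ (rgt k) true)

    gbʳˡ≡Q : g bʳˡ ≡ Q
    gbʳˡ≡Q = goal-at-BothOne b-stage (agreeOff-trans (agreeOff-setʳ k b true) (agreeOff-setˡ k bʳ true))
      (set-≡ bʳ (lft k) true , trans (set-≢ bʳ (lft k) true (lft≢rgt k k ∘ sym)) (set-≡ b (rgt k) true))

    gbˡ≤Q : g bˡ ≤ Q
    gbˡ≤Q = subst (g bˡ ≤_) gbˡʳ≡Q (monotone bˡ (rgt k) true bˡ-rgt)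

    gbʳ≤Q : g bʳ ≤ Q
    gbʳ≤Q = subst (g bʳ ≤_) gbʳˡ≡Q (monotone bʳ (lft k) true bʳ-lft)

    Q+gb≤gbʳ+gbˡ : Q + g b ≤ g bʳ + g bˡ
    Q+gb≤gbʳ+gbˡ = subst (λ x → x + g b ≤ g bʳ + g bˡ) gbˡʳ≡Q
      (submodular b bˡ (rgt k) true (set-extends b (lft k) true (proj₁ pair-unset)) (proj₂ pair-unset) bˡ-rgt)

  gap : ∀ d k {b : PA (m + m)} → k + d ≡ m → Stage k b → g b ≤ Q → g b + 2 ^ d ≤ Q
  gap zero k {b} k+0≡m b-stage gb≤Q =
    subst (_≤ Q) (+-comm 1 (g b)) (below-goal (≤-reflexive (trans (sym (+-identityʳ k)) k+0≡m)) b-stage gb≤Q)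
  gap (suc d) k {b} k+d+1≡m b-stage gb≤Q =
    gap-doubling (2 ^ d) Q+gb≤gbʳ+gbˡ (gap d _ k+1+d≡m stageˡ gbˡ≤Q) (gap d _ k+1+d≡m stageʳ gbʳ≤Q)
    where
      k<m : k < m
      k<m = subst (k <_) k+d+1≡m (m<m+n k (s≤s z≤n))
      toℕ-k : toℕ (fromℕ< k<m) ≡ k
      toℕ-k = toℕ-fromℕ< k<m
      k+1+d≡m : suc (toℕ (fromℕ< k<m)) + d ≡ m
      k+1+d≡m = trans (cong (λ j → suc j + d) toℕ-k) (trans (sym (+-suc k d)) k+d+1≡m)
      open Branches {k = fromℕ< k<m} {b = b} (subst (λ j → Stage j b) (sym toℕ-k) b-stage)

  2^m≤Q : g (λ _ → nothing) ≡ 0 → 2 ^ m ≤ Q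
  2^m≤Q g∅≡0 = subst (λ x → x + 2 ^ m ≤ Q) g∅≡0 (gap m 0 refl stage-empty (subst (_≤ Q) (sym g∅≡0) z≤n))

lemma2 : (m : ℕ) (f : (Fin (m + m) → Bool) → Bool) →
    (∀ (n' : ℕ) → n' ≤ m → (b : PA (m + m)) →
      (∀ (i : Fin m) → n' ≤ toℕ i → BothStar b i) →
      (∀ (i : Fin m) → toℕ i < n' → OneStarOneOne b i) →
      ¬ Certificate f false b × ¬ Certificate f true b) →
    (∀ (n' : ℕ) → 1 ≤ n' → n' ≤ m → (b : PA (m + m)) →
      (∀ (i : Fin m) → n' ≤ toℕ i → BothStar b i) →
      (∀ (i : Fin m) → suc (toℕ i) < n' → OneStarOneOne b i) →
      (∀ (i : Fin m) → suc (toℕ i) ≡ n' → BothOne b i) →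
      ContainsCertificate f true b) →
    QValueAtLeast f (2 ^ m)
lemma2 m f noCertificate containsCertificate Q g (monotone , submodular , g∅≡0 , goal⇔certificate) =
  LowerBound.2^m≤Q noCertificate containsCertificate monotone submodular goal⇔certificate g∅≡0
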